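{- Let $H$ be a graph and let $(\mathcal{F}_1,\dots,\mathcal{F}_{\mathrm{wpn}(H)})$ be a really canonical $H$-freeness witnessing $\mathrm{wpn}(H)$-sequence. For each $i$ let $J_i$ be the set of induced subgraphs of $H$ that are not in $\mathcal{F}_i$. Then for every $i$, $J_i$ contains a bipartite graph, a graph whose complement is bipartite, and a split graph.
   Context: A graph $G$ is $H$-free if it has no induced subgraph isomorphic to $H$. The witnessing partition number $\mathrm{wpn}(H)$ is the maximum $k$ such that for some pair of nonnegative integers $(c,s)$ with $c+s=k$ there is no partition of $V(H)$ into $c$ cliques and $s$ stable sets (parts may be empty). An $H$-freeness witnessing $k$-sequence is a sequence $(\mathcal{F}_1,\dots,\mathcal{F}_k)$ of hereditary (closed under induced subgraphs and isomorphism) families of graphs such that for every partition $X_1,\dots,X_k$ of $V(H)$ into $k$ (possibly empty) sets there is an $i$ with $H[X_i]\notin\mathcal{F}_i$. Such a sequence is canonical if for each $i$ there is a set $J_i$ of induced subgraphs of $H$ such that $\mathcal{F}_i$ consists exactly of the graphs containing no member of $J_i$ as an induced subgraph; it is really canonical if it is canonical and each $\mathcal{F}_i$ contains arbitrarily large graphs (equivalently, each $\mathcal{F}_i$ contains all cliques or all stable sets). A graph is split if its vertex set can be partitioned into a clique and a stable set. -}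

module Defs where

open import Data.Nat using (ℕ; _≤_; _+_)
open import Data.Fin using (Fin; _≟_)
open import Data.Bool using (Bool; true; false; not; _∧_)
open import Data.Bool.Properties using (∧-zeroʳ)
open import Data.List using (List; filter; length; lookup; allFin)
open import Data.Product using (Σ; ∃; ∃-syntax; _×_; _,_)
open import Data.Sum using (_⊎_; inj₁; inj₂)
open import Data.Empty using (⊥-elim)
open import Relation.Nullary using (¬_; yes; no; Dec)
open import Relation.Nullary.Decidable using (⌊_⌋)
open import Relation.Binary.PropositionalEquality using (_≡_; _≢_; refl; sym; cong)
open import Function.Definitions using (Injective)

record Graph (n : ℕ) : Set where
  field
    adj    : Fin n → Fin n → Bool
    adj-sym    : ∀ u v → adj u v ≡ adj v u
    adj-irrefl : ∀ v → adj v v ≡ false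
open Graph public

-- Induced embedding of G' (on Fin m) into G (on Fin n): an injective map
-- preserving adjacency and non-adjacency.  G' is (isomorphic to) an
-- induced subgraph of G iff such an embedding exists.
IsInducedEmbedding : ∀ {m n} → Graph m → Graph n → (Fin m → Fin n) → Set
IsInducedEmbedding {m} {n} G' G e =
  Injective _≡_ _≡_ e × (∀ a b → adj G (e a) (e b) ≡ adj G' a b)

_≼_ : ∀ {m n} → Graph m → Graph n → Set
G' ≼ G = ∃[ e ] IsInducedEmbedding G' G e

pullback : ∀ {m n} → Graph n → (Fin m → Fin n) → Graph m
pullback G e = record
  { adj    = λ a b → adj G (e a) (e b)
  ; adj-sym    = λ a b → adj-sym G (e a) (e b)
  ; adj-irrefl = λ a → adj-irrefl G (e a)
  }

-- The induced subgraph H[X] on the vertex set X = {v | P v}, with the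
-- vertices of X enumerated in increasing order.
subVerts : ∀ {n} {P : Fin n → Set} → (∀ v → Dec (P v)) → List (Fin n)
subVerts {n} P? = filter P? (allFin n)

inducedOn : ∀ {n} {P : Fin n → Set} → Graph n → (P? : ∀ v → Dec (P v))
          → Graph (length (subVerts P?))
inducedOn H P? = pullback H (lookup (subVerts P?))

complement : ∀ {n} → Graph n → Graph n
complement {n} G = record { adj = cadj ; adj-sym = csym ; adj-irrefl = cirr }
  where
  cadj : Fin n → Fin n → Bool
  cadj u v = not (adj G u v) ∧ not ⌊ u ≟ v ⌋
  csym : ∀ u v → cadj u v ≡ cadj v u
  csym u v with u ≟ v | v ≟ u
  ... | yes p | yes q = cong (λ b → not b ∧ false) (adj-sym G u v)
  ... | yes p | no ¬q = ⊥-elim (¬q (sym' p)) where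
        sym' : ∀ {a b : Fin n} → a ≡ b → b ≡ a
        sym' refl = refl
  ... | no ¬p | yes q = ⊥-elim (¬p (sym' q)) where
        sym' : ∀ {a b : Fin n} → a ≡ b → b ≡ a
        sym' refl = refl
  ... | no ¬p | no ¬q = cong (λ b → not b ∧ true) (adj-sym G u v)
  cirr : ∀ v → cadj v v ≡ false
  cirr v with v ≟ v
  ... | yes _ = ∧-zeroʳ (not (adj G v v))
  ... | no ¬p = ⊥-elim (¬p refl)

Bipartite : ∀ {m} → Graph m → Set
Bipartite {m} G = Σ (Fin m → Bool) λ col → (∀ u v → adj G u v ≡ true → col u ≢ col v)

CoBipartite : ∀ {m} → Graph m → Set
CoBipartite G = Bipartite (complement G)

Split : ∀ {m} → Graph m → Set
Split {m} G = Σ (Fin m → Bool) λ col →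
    (∀ u v → u ≢ v → col u ≡ true → col v ≡ true → adj G u v ≡ true)
  × (∀ u v → col u ≡ false → col v ≡ false → adj G u v ≡ false)

-- Partitions into c cliques and s stable sets (parts may be empty).

CSPartition : ∀ {n} → Graph n → ℕ → ℕ → Set
CSPartition {n} H c s = Σ (Fin n → Fin c ⊎ Fin s) λ f →
    (∀ u v j → u ≢ v → f u ≡ inj₁ j → f v ≡ inj₁ j → adj H u v ≡ true)
  × (∀ u v j → f u ≡ inj₂ j → f v ≡ inj₂ j → adj H u v ≡ false)

Witnessing : ∀ {n} → Graph n → ℕ → Set
Witnessing H k = ∃[ c ] ∃[ s ] (c + s ≡ k × ¬ CSPartition H c s)

IsWpn : ∀ {n} → Graph n → ℕ → Set
IsWpn H k = Witnessing H k × (∀ k' → Witnessing H k' → k' ≤ k)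

Family : Set₁
Family = (m : ℕ) → Graph m → Set

-- Hereditary: closed under induced subgraphs and isomorphism (both are
-- captured by induced embeddings).
Hereditary : Family → Set
Hereditary F = ∀ {m m'} (G : Graph m) (G' : Graph m') → G' ≼ G → F m G → F m' G'

IsWitnessingSeq : ∀ {n} → Graph n → (k : ℕ) → (Fin k → Family) → Set
IsWitnessingSeq {n} H k F =
    (∀ i → Hereditary (F i))
  × (∀ (p : Fin n → Fin k) → ∃[ i ] ¬ F i _ (inducedOn H (λ v → p v ≟ i)))

-- Canonical: each F i is exactly Forb(J) for a set J of induced
-- subgraphs of H.
IsCanonical : ∀ {n} → Graph n → (k : ℕ) → (Fin k → Family) → Set₁
IsCanonical {n} H k F = ∀ i → Σ Family λ J →
    (∀ m (G : Graph m) → J m G → G ≼ H)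
  × (∀ m (G : Graph m) →
       (F i m G → ¬ (∃[ m' ] Σ (Graph m') λ G' → J m' G' × G' ≼ G))
     × (¬ (∃[ m' ] Σ (Graph m') λ G' → J m' G' × G' ≼ G) → F i m G))

ArbitrarilyLarge : Family → Set
ArbitrarilyLarge F = ∀ N → ∃[ m ] (N ≤ m × Σ (Graph m) λ G → F m G)

IsReallyCanonical : ∀ {n} → Graph n → (k : ℕ) → (Fin k → Family) → Set₁
IsReallyCanonical H k F = IsCanonical H k F × (∀ i → ArbitrarilyLarge (F i))

JContains : ∀ {n} → Graph n → Family → (∀ {m} → Graph m → Set) → Set
JContains {n} H F Q = ∃[ m ] Σ (Graph m) λ G → G ≼ H × ¬ F m G × Q G

{-# OPTIONS --safe #-}
-- Ramsey's theorem turns "F j contains arbitrarily large graphs" into "F j contains every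
-- clique, or every stable set, on at most |H| vertices"; fix such a type for every j. For a
-- given i, replace the type of part i by two types of our choice: k + 1 types in all. As
-- k + 1 > wpn(H), H has a partition into cliques and stable sets of exactly these types.
-- Merging the two new parts gives a partition into k parts, so some part H[X j] lies outside
-- F j. For j ≢ i that part is a clique or stable set of the type of F j, hence in F j; so
-- j ≡ i, and H[X i] ∈ J i is the union of two parts of the chosen types: bipartite for
-- (stable, stable), co-bipartite for (clique, clique), split for (clique, stable).

module Submission where

open import Defs
open import Data.Nat using (ℕ)
open import Data.Fin using (Fin)
open import Data.Product using (_×_)

open import Data.Bool using (Bool; true; false)
open import Data.Bool.Properties using (¬-not; ∧-zeroʳ) renaming (_≟_ to _≟ᵇ_)
open import Data.Empty using (⊥-elim)
open import Data.Fin using (zero; suc; _≟_; inject≤; finToFun; funToFin)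
open import Data.Fin.Properties using (all?; any?; inject≤-injective; finToFun-funToFin)
open import Data.List using (List; []; _∷_; length; lookup; filter; allFin)
open import Data.List.Properties using (length-filter; length-tabulate)
open import Data.List.Membership.Propositional.Properties using (∈-lookup; ∈-AllPairs₂)
open import Data.List.Relation.Binary.Sublist.Propositional
  using (_⊆_; []; _∷_; _∷ʳ_; minimum; ⊆-trans)
open import Data.List.Relation.Binary.Sublist.Propositional.Properties
  using (All-resp-⊆; filter-⊆)
import Data.List.Relation.Unary.All as All
open import Data.List.Relation.Unary.All.Properties using (all-filter)
open import Data.List.Relation.Unary.AllPairs using (AllPairs; []; _∷_)
import Data.List.Relation.Unary.AllPairs as AllPairs
open import Data.List.Relation.Unary.Unique.Propositional using (Unique)
open import Data.List.Relation.Unary.Unique.Propositional.Properties using (allFin⁺; filter⁺)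
open import Data.Nat using (zero; suc; _+_; _≤_; s≤s; _≤?_)
open import Data.Nat.Properties
  using (≤-trans; +-suc; +-cancelˡ-≤; +-monoˡ-≤; <⇒≤; ≰⇒>; 1+n≰n)
open import Data.Product using (∃; ∃-syntax; _,_; proj₂)
open import Data.Sum using (_⊎_; inj₁; inj₂; [_,_])
open import Data.Vec.Functional using (updateAt)
open import Data.Vec.Functional.Properties using (updateAt-updates; updateAt-minimal)
open import Function using (_∘_; id; const)
open import Function.Definitions using (Injective)
open import Relation.Nullary using (¬_; Dec; yes; no; does)
open import Relation.Nullary.Decidable using (_→-dec_; ¬?; map′)
open import Relation.Unary.Properties using (∁?)
open import Relation.Binary.PropositionalEquality
  using (_≡_; _≢_; _≗_; refl; sym; trans; cong; subst)

AllPairs-resp-⊇ : ∀ {A : Set} {R : A → A → Set} {xs ys : List A} →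
                  ys ⊆ xs → AllPairs R xs → AllPairs R ys
AllPairs-resp-⊇ []         []       = []
AllPairs-resp-⊇ (_ ∷ʳ τ)   (_ ∷ rs) = AllPairs-resp-⊇ τ rs
AllPairs-resp-⊇ (refl ∷ τ) (r ∷ rs) = All-resp-⊆ τ r ∷ AllPairs-resp-⊇ τ rs

lookup-injective : ∀ {A : Set} {xs : List A} → Unique xs → Injective _≡_ _≡_ (lookup xs)
lookup-injective (_ ∷ _)  {zero}  {zero}  _  = refl
lookup-injective (x∉ ∷ _) {zero}  {suc j} eq = ⊥-elim (All.lookup x∉ (∈-lookup j) eq)
lookup-injective (x∉ ∷ _) {suc i} {zero}  eq = ⊥-elim (All.lookup x∉ (∈-lookup i) (sym eq))
lookup-injective (_ ∷ u)  {suc i} {suc j} eq = cong suc (lookup-injective u eq)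

length-filter+filter-∁ : ∀ {A : Set} {P : A → Set} (P? : ∀ x → Dec (P x)) xs →
                         length (filter P? xs) + length (filter (∁? P?) xs) ≡ length xs
length-filter+filter-∁ P? []       = refl
length-filter+filter-∁ P? (x ∷ xs) with does (P? x)
... | true  = cong suc (length-filter+filter-∁ P? xs)
... | false = trans (+-suc _ _) (cong suc (length-filter+filter-∁ P? xs))

length-allFin : ∀ n → length (allFin n) ≡ n
length-allFin n = length-tabulate id

+-≤⇒≤⊎≤ : ∀ {m n p q} → m + n ≤ p + q → m ≤ p ⊎ n ≤ q
+-≤⇒≤⊎≤ {m} {n} {p} {q} le with m ≤? p
... | yes m≤p = inj₁ m≤p
... | no  m≰p = inj₂ (+-cancelˡ-≤ p n q (≤-trans (+-monoˡ-≤ n (<⇒≤ (≰⇒> m≰p))) le))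

ramseyBound : ℕ → ℕ → ℕ
ramseyBound zero    _       = 0
ramseyBound (suc _) zero    = 0
ramseyBound (suc a) (suc b) = suc (ramseyBound a (suc b) + ramseyBound (suc a) b)

module _ {A : Set} {R : A → A → Set} (R? : ∀ x y → Dec (R x y)) where

  HomogeneousSublist : ℕ → ℕ → List A → Set
  HomogeneousSublist a b xs = ∃[ ys ] ys ⊆ xs ×
    (length ys ≡ a × AllPairs R ys ⊎ length ys ≡ b × AllPairs (λ x y → ¬ R x y) ys)

  private
    extend-R : ∀ {a b} x xs → HomogeneousSublist a (suc b) (filter (R? x) xs) →
               HomogeneousSublist (suc a) (suc b) (x ∷ xs)
    extend-R x xs (ys , τ , inj₁ (refl , r)) =
      x ∷ ys , refl ∷ ⊆-trans τ (filter-⊆ (R? x) xs) ,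
      inj₁ (refl , All-resp-⊆ τ (all-filter (R? x) xs) ∷ r)
    extend-R x xs (ys , τ , inj₂ s) = ys , x ∷ʳ ⊆-trans τ (filter-⊆ (R? x) xs) , inj₂ s

    extend-∁R : ∀ {a b} x xs → HomogeneousSublist (suc a) b (filter (∁? (R? x)) xs) →
                HomogeneousSublist (suc a) (suc b) (x ∷ xs)
    extend-∁R x xs (ys , τ , inj₁ r) = ys , x ∷ʳ ⊆-trans τ (filter-⊆ (∁? (R? x)) xs) , inj₁ r
    extend-∁R x xs (ys , τ , inj₂ (refl , s)) =
      x ∷ ys , refl ∷ ⊆-trans τ (filter-⊆ (∁? (R? x)) xs) ,
      inj₂ (refl , All-resp-⊆ τ (all-filter (∁? (R? x)) xs) ∷ s)

  ramsey : ∀ a b xs → ramseyBound a b ≤ length xs → HomogeneousSublist a b xs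
  ramsey zero    b       xs       _ = [] , minimum xs , inj₁ (refl , [])
  ramsey (suc a) zero    xs       _ = [] , minimum xs , inj₂ (refl , [])
  ramsey (suc a) (suc b) (x ∷ xs) (s≤s bound)
    with +-≤⇒≤⊎≤ (subst (_ ≤_) (sym (length-filter+filter-∁ (R? x) xs)) bound)
  ... | inj₁ inR  = extend-R  x xs (ramsey a (suc b) (filter (R? x) xs) inR)
  ... | inj₂ in∁R = extend-∁R x xs (ramsey (suc a) b (filter (∁? (R? x)) xs) in∁R)

Homogeneous : ∀ {m} → Bool → Graph m → Set
Homogeneous c G = ∀ u v → u ≢ v → adj G u v ≡ c

ContainsHomogeneousUpTo : ℕ → Bool → Family → Set
ContainsHomogeneousUpTo a c F = ∀ {m} (G : Graph m) → m ≤ a → Homogeneous c G → F m G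

homogeneous-≼ : ∀ {m c} (G : Graph m) {ys : List (Fin m)} →
                Unique ys → AllPairs (λ u v → adj G u v ≡ c) ys →
                ContainsHomogeneousUpTo (length ys) c (λ _ G' → G' ≼ G)
homogeneous-≼ G {ys} distinct hom G' m'≤ G'-hom = e , e-injective , e-adj
  where
  e : Fin _ → Fin _
  e a = lookup ys (inject≤ a m'≤)

  e-injective : Injective _≡_ _≡_ e
  e-injective = inject≤-injective _ _ _ _ ∘ lookup-injective distinct

  e-adj : ∀ a b → adj G (e a) (e b) ≡ adj G' a b
  e-adj a b with a ≟ b
  ... | yes refl = trans (adj-irrefl G (e a)) (sym (adj-irrefl G' a))
  ... | no a≢b with ∈-AllPairs₂ hom (∈-lookup (inject≤ a m'≤)) (∈-lookup (inject≤ b m'≤))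
  ...   | inj₁ ea≡eb        = ⊥-elim (a≢b (e-injective ea≡eb))
  ...   | inj₂ (inj₁ e-hom) = trans e-hom (sym (G'-hom a b a≢b))
  ...   | inj₂ (inj₂ e-hom) = trans (adj-sym G (e a) (e b)) (trans e-hom (sym (G'-hom a b a≢b)))

ramsey-homogeneous : ∀ a {m} (G : Graph m) → ramseyBound a a ≤ m →
                     ∃[ c ] ContainsHomogeneousUpTo a c (λ _ G' → G' ≼ G)
ramsey-homogeneous a {m} G bound
  with ramsey (λ u v → adj G u v ≟ᵇ true) a a (allFin m)
              (subst (_ ≤_) (sym (length-allFin m)) bound)
... | ys , τ , inj₁ (refl , clique) = true  , homogeneous-≼ G (AllPairs-resp-⊇ τ (allFin⁺ m)) clique
... | ys , τ , inj₂ (refl , stable) =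
  false , homogeneous-≼ G (AllPairs-resp-⊇ τ (allFin⁺ m)) (AllPairs.map ¬-not stable)

hereditary-large⇒homogeneous : ∀ {F} → Hereditary F → ArbitrarilyLarge F →
                               ∀ a → ∃[ c ] ContainsHomogeneousUpTo a c F
hereditary-large⇒homogeneous hereditary large a with large (ramseyBound a a)
... | _ , bound , G , G∈F with ramsey-homogeneous a G bound
... | c , embeds = c , λ G' m'≤a G'-hom → hereditary G G' (embeds G' m'≤a G'-hom) G∈F

module _ {n} {P : Fin n → Set} (P? : ∀ v → Dec (P v)) where

  subVerts-injective : Injective _≡_ _≡_ (lookup (subVerts P?))
  subVerts-injective = lookup-injective (filter⁺ P? (allFin⁺ n))

  subVerts-satisfy : ∀ a → P (lookup (subVerts P?) a)
  subVerts-satisfy a = All.lookup (all-filter P? (allFin n)) (∈-lookup a)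

  length-subVerts : length (subVerts P?) ≤ n
  length-subVerts = subst (length (subVerts P?) ≤_) (length-allFin n) (length-filter P? (allFin n))

  inducedOn-≼ : (H : Graph n) → inducedOn H P? ≼ H
  inducedOn-≼ H = lookup (subVerts P?) , subVerts-injective , λ _ _ → refl

record TypedPartition {n} {I : Set} (H : Graph n) (t : I → Bool) (q : Fin n → I) : Set where
  constructor typed
  field adj-typed : ∀ u v → u ≢ v → q u ≡ q v → adj H u v ≡ t (q u)
open TypedPartition

module _ {n} {I : Set} {H : Graph n} {t : I → Bool} {q : Fin n → I}
         (q-typed : TypedPartition H t q) where

  TypedPartition-resp-≗ : ∀ {q'} → q ≗ q' → TypedPartition H t q'
  TypedPartition-resp-≗ q≗q' = typed λ u v u≢v q'u≡q'v →
    trans (adj-typed q-typed u v u≢v (trans (q≗q' u) (trans q'u≡q'v (sym (q≗q' v)))))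
          (cong t (q≗q' u))

  TypedPartition-inducedOn : ∀ {P : Fin n → Set} (P? : ∀ v → Dec (P v)) →
                             TypedPartition (inducedOn H P?) t (q ∘ lookup (subVerts P?))
  TypedPartition-inducedOn P? =
    typed λ a b a≢b → adj-typed q-typed _ _ (a≢b ∘ subVerts-injective P?)

  TypedPartition-homogeneous : ∀ {x} → (∀ u → q u ≡ x) → Homogeneous (t x) H
  TypedPartition-homogeneous q≡x u v u≢v =
    trans (adj-typed q-typed u v u≢v (trans (q≡x u) (sym (q≡x v)))) (cong t (q≡x u))

  TypedPartition-recolour : ∀ {J : Set} (col : I → J) (t' : J → Bool) →
                            (∀ u v → col (q u) ≡ col (q v) → q u ≡ q v) →
                            (∀ u → t (q u) ≡ t' (col (q u))) →
                            TypedPartition H t' (col ∘ q)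
  TypedPartition-recolour col t' separates agrees = typed λ u v u≢v same →
    trans (adj-typed q-typed u v u≢v (separates u v same)) (agrees u)

module _ {K} (t : Fin K → Bool) where

  private
    isClique? : ∀ x → Dec (t x ≡ true)
    isClique? x = t x ≟ᵇ true

  cliqueSlots stableSlots : List (Fin K)
  cliqueSlots = subVerts isClique?
  stableSlots = subVerts (∁? isClique?)

  length-slots : length cliqueSlots + length stableSlots ≡ K
  length-slots = trans (length-filter+filter-∁ isClique? (allFin K)) (length-allFin K)

  slot : Fin (length cliqueSlots) ⊎ Fin (length stableSlots) → Fin K
  slot = [ lookup cliqueSlots , lookup stableSlots ]

  slot-type : ∀ x → t (slot x) ≡ [ const true , const false ] x
  slot-type (inj₁ x) = subVerts-satisfy isClique? x
  slot-type (inj₂ y) = ¬-not (subVerts-satisfy (∁? isClique?) y)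

  slot-injective : Injective _≡_ _≡_ slot
  slot-injective {inj₁ x} {inj₁ x'} eq = cong inj₁ (subVerts-injective isClique? eq)
  slot-injective {inj₂ y} {inj₂ y'} eq = cong inj₂ (subVerts-injective (∁? isClique?) eq)
  slot-injective {inj₁ x} {inj₂ y}  eq
    with () ← trans (sym (slot-type (inj₁ x))) (trans (cong t eq) (slot-type (inj₂ y)))
  slot-injective {inj₂ y} {inj₁ x}  eq = sym (slot-injective (sym eq))

  csPartition⇒typedPartition : ∀ {n} {H : Graph n} →
    CSPartition H (length cliqueSlots) (length stableSlots) → ∃ (TypedPartition H t)
  csPartition⇒typedPartition {H = H} (f , cliques , stables) = slot ∘ f , typed slot∘f-typed
    where
    slot∘f-typed : ∀ u v → u ≢ v → slot (f u) ≡ slot (f v) → adj H u v ≡ t (slot (f u))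
    slot∘f-typed u v u≢v same with slot-injective same | f u in fu
    ... | fu≡fv | inj₁ x =
      trans (cliques u v x u≢v fu (trans (sym fu≡fv) fu)) (sym (slot-type (inj₁ x)))
    ... | fu≡fv | inj₂ y =
      trans (stables u v y fu (trans (sym fu≡fv) fu)) (sym (slot-type (inj₂ y)))

any-function? : ∀ {n m} {P : (Fin n → Fin m) → Set} → (∀ {f g} → f ≗ g → P f → P g) →
                (∀ f → Dec (P f)) → Dec (∃ P)
any-function? resp P? with any? (P? ∘ finToFun)
... | yes (x , px) = yes (finToFun x , px)
... | no ¬px       = no λ (f , pf) → ¬px (funToFin f , resp (sym ∘ finToFun-funToFin f) pf)

typedPartition? : ∀ {n K} (H : Graph n) (t : Fin K → Bool) → Dec (∃ (TypedPartition H t))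
typedPartition? H t = any-function? (λ q≗q' q-typed → TypedPartition-resp-≗ q-typed q≗q') λ q →
  map′ typed adj-typed
    (all? λ u → all? λ v → ¬? (u ≟ v) →-dec (q u ≟ q v) →-dec (adj H u v ≟ᵇ t (q u)))

-- Maximality of wpn only refutes the absence of a partition; the partition itself is
-- recovered by searching the finitely many maps Fin n → Fin K.
¬witnessing⇒typedPartition : ∀ {n K} {H : Graph n} → ¬ Witnessing H K →
                             (t : Fin K → Bool) → ∃ (TypedPartition H t)
¬witnessing⇒typedPartition {H = H} ¬witnessing t with typedPartition? H t
... | yes q-typed = q-typed
... | no ¬typed   = ⊥-elim (¬witnessing
  (_ , _ , length-slots t , ¬typed ∘ csPartition⇒typedPartition t {H = H}))

mergeInto : ∀ {k} → Fin k → Fin (suc k) → Fin k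
mergeInto i zero    = i
mergeInto i (suc j) = j

isZero : ∀ {k} → Fin (suc k) → Bool
isZero zero    = true
isZero (suc _) = false

mergeInto-≢ : ∀ {k} {i j : Fin k} x → mergeInto i x ≡ j → j ≢ i → x ≡ suc j
mergeInto-≢ zero    refl i≢i = ⊥-elim (i≢i refl)
mergeInto-≢ (suc j) refl _   = refl

mergeInto-separates : ∀ {k} {i : Fin k} x y →
                      mergeInto i x ≡ mergeInto i y → isZero x ≡ isZero y → x ≡ y
mergeInto-separates zero    zero     _  _ = refl
mergeInto-separates (suc j) (suc j') eq _ = cong suc eq

splitType : ∀ {k} → (Fin k → Bool) → Fin k → (Bool → Bool) → Fin (suc k) → Bool
splitType typ i ty zero    = ty true
splitType typ i ty (suc j) = updateAt typ i (const (ty false)) j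

splitType-merged : ∀ {k} typ (i : Fin k) ty x →
                   mergeInto i x ≡ i → splitType typ i ty x ≡ ty (isZero x)
splitType-merged typ i ty zero    _    = refl
splitType-merged typ i ty (suc j) refl = updateAt-updates j typ

module _ {n k} {H : Graph n} {typ : Fin k → Bool} {i : Fin k} {ty : Bool → Bool}
         {q : Fin n → Fin (suc k)} (q-typed : TypedPartition H (splitType typ i ty) q) where

  inPart? : ∀ j v → Dec (mergeInto i (q v) ≡ j)
  inPart? j v = mergeInto i (q v) ≟ j

  otherPart-homogeneous : ∀ {j} → j ≢ i → Homogeneous (typ j) (inducedOn H (inPart? j))
  otherPart-homogeneous {j} j≢i = subst (λ c → Homogeneous c (inducedOn H (inPart? j)))
    (updateAt-minimal j i typ j≢i)
    (TypedPartition-homogeneous (TypedPartition-inducedOn q-typed (inPart? j))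
      λ a → mergeInto-≢ (q _) (subVerts-satisfy (inPart? j) a) j≢i)

  mergedPart-typed : TypedPartition (inducedOn H (inPart? i)) ty
                                    (isZero ∘ q ∘ lookup (subVerts (inPart? i)))
  mergedPart-typed =
    TypedPartition-recolour (TypedPartition-inducedOn q-typed (inPart? i)) isZero ty
    (λ a b → mergeInto-separates (q _) (q _) (trans (inPart a) (sym (inPart b))))
    (λ a → splitType-merged typ i ty (q _) (inPart a))
    where
    inPart : ∀ a → mergeInto i (q (lookup (subVerts (inPart? i)) a)) ≡ i
    inPart = subVerts-satisfy (inPart? i)

JContains-typedPartition : ∀ {n k} {H : Graph n} {F : Fin k → Family} →
  (∀ (p : Fin n → Fin k) → ∃[ j ] ¬ F j _ (inducedOn H (λ v → p v ≟ j))) →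
  ¬ Witnessing H (suc k) →
  ∀ {typ} → (∀ j → ContainsHomogeneousUpTo n (typ j) (F j)) →
  ∀ i (ty : Bool → Bool) → JContains H (F i) (λ G → ∃ (TypedPartition G ty))
JContains-typedPartition {H = H} witnessing ¬witnessing {typ} contains i ty
  with ¬witnessing⇒typedPartition {H = H} ¬witnessing (splitType typ i ty)
... | q , q-typed with witnessing (mergeInto i ∘ q)
... | j , part∉Fj with j ≟ i
... | no j≢i   =
  ⊥-elim (part∉Fj (contains j _ (length-subVerts _) (otherPart-homogeneous q-typed j≢i)))
... | yes refl = _ , _ , inducedOn-≼ _ H , part∉Fj , _ , mergedPart-typed q-typed

JContains-map : ∀ {n} (H : Graph n) {F} {Q Q' : ∀ {m} → Graph m → Set} →
                (∀ {m} {G : Graph m} → Q G → Q' G) → JContains H F Q → JContains H F Q'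
JContains-map _ Q⇒Q' (m , G , G≼H , G∉F , QG) = m , G , G≼H , G∉F , Q⇒Q' QG

stableClasses⇒bipartite : ∀ {m} {G : Graph m} → ∃ (TypedPartition G (const false)) → Bipartite G
stableClasses⇒bipartite {G = G} (col , typed stable) = col , no-monochromatic-edge
  where
  no-monochromatic-edge : ∀ u v → adj G u v ≡ true → col u ≢ col v
  no-monochromatic-edge u v uv same with u ≟ v
  ... | yes refl with () ← trans (sym (adj-irrefl G u)) uv
  ... | no u≢v   with () ← trans (sym (stable u v u≢v same)) uv

cliqueClasses⇒coBipartite : ∀ {m} {G : Graph m} →
                            ∃ (TypedPartition G (const true)) → CoBipartite G
cliqueClasses⇒coBipartite {G = G} (col , typed clique) = col , no-monochromatic-nonEdge
  where
  no-monochromatic-nonEdge : ∀ u v → adj (complement G) u v ≡ true → col u ≢ col v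
  no-monochromatic-nonEdge u v uv same with u ≟ v
  ... | yes refl with () ← trans (sym (∧-zeroʳ _)) uv
  ... | no u≢v rewrite clique u v u≢v same with () ← uv

identityClasses⇒split : ∀ {m} {G : Graph m} → ∃ (TypedPartition G id) → Split G
identityClasses⇒split {G = G} (col , typed typed-col) = col , clique , stable
  where
  clique : ∀ u v → u ≢ v → col u ≡ true → col v ≡ true → adj G u v ≡ true
  clique u v u≢v cu cv = trans (typed-col u v u≢v (trans cu (sym cv))) cu
  stable : ∀ u v → col u ≡ false → col v ≡ false → adj G u v ≡ false
  stable u v cu cv with u ≟ v
  ... | yes refl = adj-irrefl G u
  ... | no u≢v   = trans (typed-col u v u≢v (trans cu (sym cv))) cu

mainTheorem5 : ∀ {n} (H : Graph n) (k : ℕ) → IsWpn H k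
    → (F : Fin k → Family) → IsWitnessingSeq H k F → IsReallyCanonical H k F
    → ∀ i → JContains H (F i) Bipartite × JContains H (F i) CoBipartite × JContains H (F i) Split
mainTheorem5 {n} H k (_ , maximal) F (hereditary , witnessing) (_ , large) i =
    JContains-map H stableClasses⇒bipartite (forbidden (const false))
  , JContains-map H cliqueClasses⇒coBipartite (forbidden (const true))
  , JContains-map H identityClasses⇒split (forbidden id)
  where
  homogeneousTypes : ∀ j → ∃[ c ] ContainsHomogeneousUpTo n c (F j)
  homogeneousTypes j = hereditary-large⇒homogeneous (hereditary j) (large j) n

  forbidden : ∀ ty → JContains H (F i) (λ G → ∃ (TypedPartition G ty))
  forbidden = JContains-typedPartition {H = H} witnessing (λ w → 1+n≰n (maximal _ w))
                                       (proj₂ ∘ homogeneousTypes) i
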